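{- Let $r,s\ge1$ be integers. For all integers $n\ge 1$, \[ \bar{a}_{r,s}(n)\equiv \begin{cases} 2s\pmod 4, & \text{if } n=k^2 \text{ for some integer } k,\\ 2(r+s)\pmod 4, & \text{if } n=2k^2 \text{ for some integer } k,\\ 0 \pmod 4, & \text{otherwise}. \end{cases} \]
   Context: For $m\ge1$ let $f_m:=\prod_{k=1}^{\infty}(1-q^{mk})$. For integers $r,s\ge1$, $\bar{a}_{r,s}(n)$ denotes the number of overpartitions of $n$ (partitions in which the first occurrence of each part size may be overlined) wherein each even part may appear in one of $r$ colors and each odd part in one of $s$ colors; its generating function is \[ \sum_{n=0}^{\infty}\bar{a}_{r,s}(n)q^n=\frac{f_2^{3s-2r}}{f_1^{2s}f_4^{s-r}}. \] -}

module Defs where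

open import Data.Nat using (ℕ; zero; suc; _+_; _*_; _∸_; _%_)
open import Data.Nat.Divisibility using (_∣?_)
open import Data.Bool using (if_then_else_)
open import Data.List using (map; upTo)
open import Data.Nat.ListAction using (sum)
open import Relation.Nullary.Decidable using (⌊_⌋)

Series : Set
Series = ℕ → ℕ

one : Series
one zero    = 1
one (suc _) = 0

_·_ : Series → Series → Series
(f · g) n = sum (map (λ i → f i * g (n ∸ i)) (upTo (suc n)))

_^ˢ_ : Series → ℕ → Series
f ^ˢ zero  = one
f ^ˢ suc k = f · (f ^ˢ k)

-- The series (1 + q^m)/(1 - q^m) = 1 + 2 q^m + 2 q^{2m} + …  (for m ≥ 1):
-- the contribution of one coloured part size m in an overpartition
-- (multiplicity j ≥ 1, first occurrence overlined or not: 2 ways).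
overFactor : ℕ → Series
overFactor m zero    = 1
overFactor m (suc n) = if ⌊ m ∣? suc n ⌋ then 2 else 0

colours : ℕ → ℕ → ℕ → ℕ
colours r s m = if ⌊ m % 2 Data.Nat.≟ 0 ⌋ then r else s

partialProduct : ℕ → ℕ → ℕ → Series
partialProduct r s zero    = one
partialProduct r s (suc N) = (overFactor (suc N) ^ˢ colours r s (suc N)) · partialProduct r s N

-- ā_{r,s}(n): coefficient of q^n in
--   ∏_{m≥1} ((1+q^m)/(1-q^m))^{colours m} = f₂^{3s-2r} / (f₁^{2s} f₄^{s-r}).
-- Factors with m > n do not affect the coefficient of q^n, so the
-- product up to m = n suffices.
abar : ℕ → ℕ → ℕ → ℕ
abar r s n = partialProduct r s n n

-- Modulo 4 each factor (1 + q^m)/(1 - q^m) = 1 + 2 (q^m + q^{2m} + …) is of the form 1 + 2X, and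
-- (1 + 2X)(1 + 2Y) ≡ 1 + 2(X + Y), so for n ≥ 1 the coefficient ā_{r,s}(n) is congruent to
-- 2 Σ_{d ∣ n} c(d), where c(d) is r for even d and s for odd d. As c(d) ≡ (r + s)[d even] + s
-- (mod 2), this is 2((r + s) E(n) + s τ(n)) with τ(n) the number of divisors and E(n) the number of
-- even divisors. Pairing d with n / d shows that τ(n) is odd exactly for squares; E(2N) = τ(N) and
-- E vanishes on odd numbers, so E(n) is odd exactly for twice a square. By the irrationality of √2
-- no number is both.
module Submission where

open import Defs
open import Data.Nat
  using (ℕ; zero; suc; _+_; _*_; _∸_; _%_; _≤_; _<_; s≤s; z<s; _≟_; _<?_; NonZero; ≢-nonZero⁻¹)
open import Data.Nat.Properties
open import Data.Nat.DivMod using ([m+kn]%n≡m%n; m*n%n≡0; %-distribˡ-+; %-distribˡ-*)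
open import Data.Nat.Divisibility
  using (divides; _∣?_; ∣-trans; *-monoʳ-∣; *-cancelˡ-∣; n∣m⇒m%n≡0; m%n≡0⇒n∣m)
open import Algebra.Properties.CommutativeSemigroup +-commutativeSemigroup
  using () renaming (interchange to +-interchange)
open import Data.Nat.Induction using (<-rec)
open import Data.Nat.Primality using (euclidsLemma; prime[2])
open import Data.Nat.Tactic.RingSolver using (solve-∀)
open import Data.List using (_∷_; _∷ʳ_; applyUpTo)
open import Data.List.Properties using (map-applyUpTo; applyUpTo-∷ʳ)
open import Data.Nat.ListAction using (sum)
open import Data.Nat.ListAction.Properties using (sum-++)
open import Data.Product using (_×_; _,_; ∃-syntax)
open import Data.Sum using (_⊎_; inj₁; inj₂; reduce)
open import Relation.Binary.Definitions using (tri<; tri≈; tri>)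
open import Relation.Binary.PropositionalEquality
open import Relation.Nullary using (¬_; Dec; yes; no; contradiction)

∑< : ℕ → (ℕ → ℕ) → ℕ
∑< zero    f = 0
∑< (suc n) f = ∑< n f + f n

-- The summand extends over _+_ and _*_: ∑[ i < n ] f i + g i sums f i + g i.
infix 5 ∑<
syntax ∑< n (λ i → e) = ∑[ i < n ] e

module _ {f g : ℕ → ℕ} where

  ∑-cong : ∀ n → (∀ i → i < n → f i ≡ g i) → ∑< n f ≡ ∑< n g
  ∑-cong zero    f≡g = refl
  ∑-cong (suc n) f≡g = cong₂ _+_ (∑-cong n (λ i i<n → f≡g i (m<n⇒m<1+n i<n))) (f≡g n ≤-refl)

  ∑-+ : ∀ n → ∑[ i < n ] (f i + g i) ≡ ∑< n f + ∑< n g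
  ∑-+ zero    = refl
  ∑-+ (suc n) = trans (cong (_+ (f n + g n)) (∑-+ n)) (+-interchange (∑< n f) (∑< n g) (f n) (g n))

  ∑-cong-% : ∀ d .{{_ : NonZero d}} n → (∀ i → f i % d ≡ g i % d) → ∑< n f % d ≡ ∑< n g % d
  ∑-cong-% d zero    f≡g = refl
  ∑-cong-% d (suc n) f≡g = begin
    (∑< n f + f n) % d             ≡⟨ %-distribˡ-+ (∑< n f) (f n) d ⟩
    (∑< n f % d + f n % d) % d     ≡⟨ cong₂ (λ x y → (x + y) % d) (∑-cong-% d n f≡g) (f≡g n) ⟩
    (∑< n g % d + g n % d) % d     ≡⟨ %-distribˡ-+ (∑< n g) (g n) d ⟨
    (∑< n g + g n) % d             ∎
    where open ≡-Reasoning

∑-+₃ : ∀ n (f g h : ℕ → ℕ) → ∑[ i < n ] (f i + g i + h i) ≡ ∑< n f + ∑< n g + ∑< n h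
∑-+₃ n f g h = trans (∑-+ {λ i → f i + g i} {h} n) (cong (_+ ∑< n h) (∑-+ {f} {g} n))

∑-*ˡ : ∀ c n (f : ℕ → ℕ) → ∑[ i < n ] (c * f i) ≡ c * ∑< n f
∑-*ˡ c zero    f = sym (*-zeroʳ c)
∑-*ˡ c (suc n) f = trans (cong (_+ c * f n) (∑-*ˡ c n f)) (sym (*-distribˡ-+ c (∑< n f) (f n)))

∑-zero : ∀ n (f : ℕ → ℕ) → (∀ i → i < n → f i ≡ 0) → ∑< n f ≡ 0
∑-zero zero    f f≡0 = refl
∑-zero (suc n) f f≡0 = cong₂ _+_ (∑-zero n f (λ i i<n → f≡0 i (m<n⇒m<1+n i<n))) (f≡0 n ≤-refl)

∑-δ : ∀ n (f : ℕ → ℕ) {j} → j < n → (∀ i → i < n → i ≢ j → f i ≡ 0) → ∑< n f ≡ f j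
∑-δ (suc n) f {j} j<1+n f≡0 with j ≟ n
... | yes refl = cong (_+ f n) (∑-zero n f (λ i i<n → f≡0 i (m<n⇒m<1+n i<n) (<⇒≢ i<n)))
... | no j≢n   = begin
  ∑< n f + f n
    ≡⟨ cong₂ _+_ (∑-δ n f j<n (λ i i<n → f≡0 i (m<n⇒m<1+n i<n))) (f≡0 n ≤-refl (≢-sym j≢n)) ⟩
  f j + 0       ≡⟨ +-identityʳ (f j) ⟩
  f j           ∎
  where
  open ≡-Reasoning
  j<n : j < n
  j<n = ≤∧≢⇒< (≤-pred j<1+n) j≢n

∑-swap : ∀ m n (f : ℕ → ℕ → ℕ) → ∑[ a < m ] ∑[ b < n ] f a b ≡ ∑[ b < n ] ∑[ a < m ] f a b
∑-swap zero    n f = sym (∑-zero n (λ _ → 0) (λ _ _ → refl))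
∑-swap (suc m) n f = trans (cong (_+ (∑[ b < n ] f m b)) (∑-swap m n f))
                           (sym (∑-+ {λ b → ∑[ a < m ] f a b} {f m} n))

∑-pairs : ∀ C (f : ℕ → ℕ) → ∑< (2 * C) f ≡ ∑[ j < C ] (f (2 * j) + f (1 + 2 * j))
∑-pairs zero    f = refl
∑-pairs (suc C) f = begin
  ∑< (2 * suc C) f                            ≡⟨ cong (λ k → ∑< k f) (*-suc 2 C) ⟩
  ∑< (2 * C) f + f (2 * C) + f (1 + 2 * C)     ≡⟨ +-assoc (∑< (2 * C) f) _ _ ⟩
  ∑< (2 * C) f + (f (2 * C) + f (1 + 2 * C))   ≡⟨ cong (_+ (f (2 * C) + f (1 + 2 * C))) (∑-pairs C f) ⟩
  ∑[ j < suc C ] (f (2 * j) + f (1 + 2 * j))   ∎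
  where open ≡-Reasoning

sum-applyUpTo : ∀ (f : ℕ → ℕ) n → sum (applyUpTo f n) ≡ ∑< n f
sum-applyUpTo f zero    = refl
sum-applyUpTo f (suc n) = begin
  sum (applyUpTo f (suc n))          ≡⟨ cong sum (applyUpTo-∷ʳ f n) ⟨
  sum (applyUpTo f n ∷ʳ f n)         ≡⟨ sum-++ (applyUpTo f n) (f n ∷ _) ⟩
  sum (applyUpTo f n) + (f n + 0)    ≡⟨ cong₂ _+_ (sum-applyUpTo f n) (+-identityʳ (f n)) ⟩
  ∑< n f + f n                       ∎
  where open ≡-Reasoning

𝟙 : {P : Set} → Dec P → ℕ
𝟙 (yes _) = 1
𝟙 (no _)  = 0

𝟙-yes : ∀ {P : Set} (P? : Dec P) → P → 𝟙 P? ≡ 1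
𝟙-yes (yes _) p = refl
𝟙-yes (no ¬p) p = contradiction p ¬p

𝟙-no : ∀ {P : Set} (P? : Dec P) → ¬ P → 𝟙 P? ≡ 0
𝟙-no (yes p) ¬p = contradiction p ¬p
𝟙-no (no _)  ¬p = refl

𝟙-cong : ∀ {P Q : Set} (P? : Dec P) (Q? : Dec Q) → (P → Q) → (Q → P) → 𝟙 P? ≡ 𝟙 Q?
𝟙-cong (yes p) Q? P→Q Q→P = sym (𝟙-yes Q? (P→Q p))
𝟙-cong (no ¬p) Q? P→Q Q→P = sym (𝟙-no Q? (λ q → ¬p (Q→P q)))

𝟙-trichotomy : ∀ a b → 𝟙 (a <? b) + 𝟙 (a ≟ b) + 𝟙 (b <? a) ≡ 1
𝟙-trichotomy a b with <-cmp a b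
... | tri< a<b a≢b a≯b =
  cong₂ _+_ (cong₂ _+_ (𝟙-yes (a <? b) a<b) (𝟙-no (a ≟ b) a≢b)) (𝟙-no (b <? a) a≯b)
... | tri≈ a≮b a≡b a≯b =
  cong₂ _+_ (cong₂ _+_ (𝟙-no (a <? b) a≮b) (𝟙-yes (a ≟ b) a≡b)) (𝟙-no (b <? a) a≯b)
... | tri> a≮b a≢b a>b =
  cong₂ _+_ (cong₂ _+_ (𝟙-no (a <? b) a≮b) (𝟙-no (a ≟ b) a≢b)) (𝟙-yes (b <? a) a>b)

∑∑-symmetric : ∀ n (f : ℕ → ℕ → ℕ) → (∀ a b → f a b ≡ f b a) →
  ∑[ a < n ] ∑[ b < n ] f a b ≡ (∑[ a < n ] f a a) + 2 * (∑[ a < n ] ∑[ b < n ] 𝟙 (a <? b) * f a b)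
∑∑-symmetric n f f-sym = begin
  ∑[ a < n ] ∑[ b < n ] f a b
      ≡⟨ ∑-cong n (λ a _ → ∑-cong n (λ b _ → split a b)) ⟩
  ∑[ a < n ] ∑[ b < n ] (above a b + on a b + below a b)
      ≡⟨ ∑-cong n (λ a _ → ∑-+₃ n (above a) (on a) (below a)) ⟩
  ∑[ a < n ] (∑< n (above a) + ∑< n (on a) + ∑< n (below a))
      ≡⟨ ∑-+₃ n (λ a → ∑< n (above a)) (λ a → ∑< n (on a)) (λ a → ∑< n (below a)) ⟩
  Above + (∑[ a < n ] ∑< n (on a)) + (∑[ a < n ] ∑< n (below a))
      ≡⟨ cong₂ (λ x y → Above + x + y) (∑-cong n diagonal) below≡above ⟩
  Above + (∑[ a < n ] f a a) + Above                         ≡⟨ rearrange Above _ ⟩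
  (∑[ a < n ] f a a) + 2 * Above                             ∎
  where
  open ≡-Reasoning
  above on below : ℕ → ℕ → ℕ
  above a b = 𝟙 (a <? b) * f a b
  on    a b = 𝟙 (a ≟ b) * f a b
  below a b = 𝟙 (b <? a) * f a b
  Above : ℕ
  Above = ∑[ a < n ] ∑< n (above a)
  split : ∀ a b → f a b ≡ above a b + on a b + below a b
  split a b = sym (trans (sym (*-distribʳ-+₃ (𝟙 (a <? b)) (𝟙 (a ≟ b)) (𝟙 (b <? a)) (f a b)))
                         (trans (cong (_* f a b) (𝟙-trichotomy a b)) (*-identityˡ (f a b))))
    where
    *-distribʳ-+₃ : ∀ x y z w → (x + y + z) * w ≡ x * w + y * w + z * w
    *-distribʳ-+₃ = solve-∀
  diagonal : ∀ a → a < n → ∑< n (on a) ≡ f a a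
  diagonal a a<n = trans (∑-δ n (on a) a<n (λ b _ b≢a → cong (_* f a b) (𝟙-no (a ≟ b) (≢-sym b≢a))))
                         (trans (cong (_* f a a) (𝟙-yes (a ≟ a) refl)) (*-identityˡ (f a a)))
  below≡above : ∑[ a < n ] ∑< n (below a) ≡ Above
  below≡above = trans (∑-swap n n below)
                      (∑-cong n (λ a _ → ∑-cong n (λ b _ → cong (𝟙 (a <? b) *_) (f-sym b a))))
  rearrange : ∀ x y → x + y + x ≡ y + 2 * x
  rearrange = solve-∀

*-cong-% : ∀ d .{{_ : NonZero d}} x x′ y y′ → x % d ≡ x′ % d → y % d ≡ y′ % d →
           (x * y) % d ≡ (x′ * y′) % d
*-cong-% d x x′ y y′ x≡x′ y≡y′ = begin
  (x * y) % d                ≡⟨ %-distribˡ-* x y d ⟩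
  (x % d * (y % d)) % d      ≡⟨ cong₂ (λ u v → (u * v) % d) x≡x′ y≡y′ ⟩
  (x′ % d * (y′ % d)) % d    ≡⟨ %-distribˡ-* x′ y′ d ⟨
  (x′ * y′) % d              ∎
  where open ≡-Reasoning

·-as-∑ : ∀ (f g : Series) n → (f · g) n ≡ ∑[ i < suc n ] f i * g (n ∸ i)
·-as-∑ f g n = trans (cong sum (map-applyUpTo (λ i → i) (λ i → f i * g (n ∸ i)) (suc n)))
                     (sum-applyUpTo (λ i → f i * g (n ∸ i)) (suc n))

·-identityˡ : ∀ (f : Series) n → (one · f) n ≡ f n
·-identityˡ f n = begin
  (one · f) n       ≡⟨ ·-as-∑ one f n ⟩
  ∑[ i < suc n ] one i * f (n ∸ i)
      ≡⟨ ∑-δ (suc n) (λ i → one i * f (n ∸ i)) z<s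
             (λ { zero _ 0≢0 → contradiction refl 0≢0 ; (suc _) _ _ → refl }) ⟩
  1 * f n           ≡⟨ *-identityˡ (f n) ⟩
  f n               ∎
  where open ≡-Reasoning

one-∸ : ∀ {i n} → i < n → one (n ∸ i) ≡ 0
one-∸ {zero}  {suc n} _         = refl
one-∸ {suc i} {suc n} (s≤s i<n) = one-∸ i<n

·-identityʳ : ∀ (f : Series) n → (f · one) n ≡ f n
·-identityʳ f n = begin
  (f · one) n       ≡⟨ ·-as-∑ f one n ⟩
  ∑[ i < suc n ] f i * one (n ∸ i)
      ≡⟨ ∑-δ (suc n) (λ i → f i * one (n ∸ i)) ≤-refl
             (λ i i<1+n i≢n → trans (cong (f i *_) (one-∸ (≤∧≢⇒< (≤-pred i<1+n) i≢n)))
                                     (*-zeroʳ (f i))) ⟩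
  f n * one (n ∸ n) ≡⟨ cong (λ k → f n * one k) (n∸n≡0 n) ⟩
  f n * 1           ≡⟨ *-identityʳ (f n) ⟩
  f n               ∎
  where open ≡-Reasoning

infix 4 _≡1+2·_mod4
record _≡1+2·_mod4 (f a : Series) : Set where
  constructor coefficientwise
  field at : ∀ n → f n % 4 ≡ (one n + 2 * a n) % 4
open _≡1+2·_mod4

one-mod4 : one ≡1+2· (λ _ → 0) mod4
one-mod4 = coefficientwise λ n → cong (_% 4) (sym (+-identityʳ (one n)))

*-mod4 : ∀ x y u a v b → x % 4 ≡ (u + 2 * a) % 4 → y % 4 ≡ (v + 2 * b) % 4 →
  (x * y) % 4 ≡ (u * v + 2 * (a * v) + 2 * (u * b)) % 4
*-mod4 x y u a v b x≡u+2a y≡v+2b = begin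
  (x * y) % 4                                  ≡⟨ *-cong-% 4 x (u + 2 * a) y (v + 2 * b) x≡u+2a y≡v+2b ⟩
  ((u + 2 * a) * (v + 2 * b)) % 4              ≡⟨ cong (_% 4) (expand u a v b) ⟩
  (uv+2av+2ub + (a * b) * 4) % 4               ≡⟨ [m+kn]%n≡m%n uv+2av+2ub (a * b) 4 ⟩
  uv+2av+2ub % 4                               ∎
  where
  open ≡-Reasoning
  uv+2av+2ub : ℕ
  uv+2av+2ub = u * v + 2 * (a * v) + 2 * (u * b)
  expand : ∀ u a v b → (u + 2 * a) * (v + 2 * b) ≡ u * v + 2 * (a * v) + 2 * (u * b) + (a * b) * 4
  expand = solve-∀

·-mod4 : ∀ {f g a b} → f ≡1+2· a mod4 → g ≡1+2· b mod4 → f · g ≡1+2· (λ n → a n + b n) mod4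
·-mod4 {f} {g} {a} {b} f≡ g≡ = coefficientwise coefficient
  where
  coefficient : ∀ n → (f · g) n % 4 ≡ (one n + 2 * (a n + b n)) % 4
  coefficient n = begin
    (f · g) n % 4                                    ≡⟨ cong (_% 4) (·-as-∑ f g n) ⟩
    (∑[ i < suc n ] f i * g (n ∸ i)) % 4             ≡⟨ ∑-cong-% 4 (suc n) termwise ⟩
    (∑[ i < suc n ] u i + 2 * v i + 2 * w i) % 4
      ≡⟨ cong (_% 4) (∑-+₃ (suc n) u (λ i → 2 * v i) (λ i → 2 * w i)) ⟩
    (U + (∑[ i < suc n ] 2 * v i) + (∑[ i < suc n ] 2 * w i)) % 4
      ≡⟨ cong₂ (λ x y → (U + x + y) % 4) (∑-*ˡ 2 (suc n) v) (∑-*ˡ 2 (suc n) w) ⟩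
    (U + 2 * V + 2 * W) % 4
      ≡⟨ cong₂ (λ x y → (x + 2 * y + 2 * W) % 4) (unit one one (·-identityˡ one n)) (unit a one (·-identityʳ a n)) ⟩
    (one n + 2 * a n + 2 * W) % 4
      ≡⟨ cong (λ z → (one n + 2 * a n + 2 * z) % 4) (unit one b (·-identityˡ b n)) ⟩
    (one n + 2 * a n + 2 * b n) % 4
      ≡⟨ cong (_% 4) (regroup (one n) (a n) (b n)) ⟩
    (one n + 2 * (a n + b n)) % 4                   ∎
    where
    open ≡-Reasoning
    u v w : ℕ → ℕ
    u i = one i * one (n ∸ i)
    v i = a i * one (n ∸ i)
    w i = one i * b (n ∸ i)
    U V W : ℕ
    U = ∑< (suc n) u
    V = ∑< (suc n) v
    W = ∑< (suc n) w
    termwise : ∀ i → (f i * g (n ∸ i)) % 4 ≡ (u i + 2 * v i + 2 * w i) % 4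
    termwise i = *-mod4 (f i) (g (n ∸ i)) (one i) (a i) (one (n ∸ i)) (b (n ∸ i))
                        (at f≡ i) (at g≡ (n ∸ i))
    unit : ∀ (f g : Series) {x} → (f · g) n ≡ x → (∑[ i < suc n ] f i * g (n ∸ i)) ≡ x
    unit f g = trans (sym (·-as-∑ f g n))
    regroup : ∀ x y z → x + 2 * y + 2 * z ≡ x + 2 * (y + z)
    regroup = solve-∀

^ˢ-mod4 : ∀ {f a} → f ≡1+2· a mod4 → ∀ c → f ^ˢ c ≡1+2· (λ n → c * a n) mod4
^ˢ-mod4 f≡ zero    = one-mod4
^ˢ-mod4 f≡ (suc c) = ·-mod4 f≡ (^ˢ-mod4 f≡ c)

positiveMultiples : ℕ → Series
positiveMultiples m zero    = 0
positiveMultiples m (suc n) = 𝟙 (m ∣? suc n)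

overFactor-mod4 : ∀ m → overFactor m ≡1+2· positiveMultiples m mod4
overFactor-mod4 m = coefficientwise coefficient
  where
  coefficient : ∀ n → overFactor m n % 4 ≡ (one n + 2 * positiveMultiples m n) % 4
  coefficient zero    = refl
  coefficient (suc n) with m ∣? suc n
  ... | yes _ = refl
  ... | no _  = refl

partialProduct-mod4 : ∀ r s N →
  partialProduct r s N ≡1+2· (λ n → ∑[ m < N ] colours r s (suc m) * positiveMultiples (suc m) n) mod4
partialProduct-mod4 r s zero          = one-mod4
partialProduct-mod4 r s (suc N) = coefficientwise λ n → trans
  (at (·-mod4 (^ˢ-mod4 (overFactor-mod4 (suc N)) (colours r s (suc N))) (partialProduct-mod4 r s N)) n)
  (cong (λ x → (one n + 2 * x) % 4) (+-comm (colours r s (suc N) * positiveMultiples (suc N) n) _))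

abar-mod4 : ∀ r s n →
  abar r s (suc n) % 4 ≡ (2 * (∑[ m < suc n ] colours r s (suc m) * 𝟙 (suc m ∣? suc n))) % 4
abar-mod4 r s n = at (partialProduct-mod4 r s (suc n)) (suc n)

isEven : ℕ → ℕ
isEven m = 𝟙 (m % 2 ≟ 0)

divisorCount evenDivisorCount : ℕ → ℕ
divisorCount     n = ∑[ m < n ] 𝟙 (suc m ∣? n)
evenDivisorCount n = ∑[ m < n ] isEven (suc m) * 𝟙 (suc m ∣? n)

colours-isEven : ∀ r s m → colours r s m + 2 * (s * isEven m) ≡ (r + s) * isEven m + s
colours-isEven r s m with m % 2 ≟ 0
... | yes _ = even-case r s
  where
  even-case : ∀ r s → r + 2 * (s * 1) ≡ (r + s) * 1 + s
  even-case = solve-∀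
... | no _  = odd-case r s
  where
  odd-case : ∀ r s → s + 2 * (s * 0) ≡ (r + s) * 0 + s
  odd-case = solve-∀

colouredDivisorSum : ∀ r s n →
  (∑[ m < n ] colours r s (suc m) * 𝟙 (suc m ∣? n)) + 2 * (s * evenDivisorCount n)
    ≡ (r + s) * evenDivisorCount n + s * divisorCount n
colouredDivisorSum r s n = begin
  ∑< n (λ m → c m * d m) + 2 * (s * ∑< n (λ m → e m * d m))
    ≡⟨ cong (λ x → ∑< n (λ m → c m * d m) + 2 * x) (∑-*ˡ s n (λ m → e m * d m)) ⟨
  ∑< n (λ m → c m * d m) + 2 * ∑< n (λ m → s * (e m * d m))
    ≡⟨ cong (∑< n (λ m → c m * d m) +_) (∑-*ˡ 2 n (λ m → s * (e m * d m))) ⟨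
  ∑< n (λ m → c m * d m) + ∑< n (λ m → 2 * (s * (e m * d m)))
    ≡⟨ ∑-+ n ⟨
  ∑< n (λ m → c m * d m + 2 * (s * (e m * d m)))
    ≡⟨ ∑-cong n (λ m _ → termwise (c m) (e m) (d m) (colours-isEven r s (suc m))) ⟩
  ∑< n (λ m → (r + s) * (e m * d m) + s * d m)
    ≡⟨ ∑-+ n ⟩
  ∑< n (λ m → (r + s) * (e m * d m)) + ∑< n (λ m → s * d m)
    ≡⟨ cong₂ _+_ (∑-*ˡ (r + s) n (λ m → e m * d m)) (∑-*ˡ s n d) ⟩
  (r + s) * evenDivisorCount n + s * divisorCount n    ∎
  where
  open ≡-Reasoning
  c e d : ℕ → ℕ
  c m = colours r s (suc m)
  e m = isEven (suc m)
  d m = 𝟙 (suc m ∣? n)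
  termwise : ∀ c e d → c + 2 * (s * e) ≡ (r + s) * e + s →
             c * d + 2 * (s * (e * d)) ≡ (r + s) * (e * d) + s * d
  termwise c e d eq = begin
    c * d + 2 * (s * (e * d))    ≡⟨ factor s c e d ⟩
    (c + 2 * (s * e)) * d        ≡⟨ cong (_* d) eq ⟩
    ((r + s) * e + s) * d        ≡⟨ distribute r s e d ⟩
    (r + s) * (e * d) + s * d    ∎
    where
    factor : ∀ s c e d → c * d + 2 * (s * (e * d)) ≡ (c + 2 * (s * e)) * d
    factor = solve-∀
    distribute : ∀ r s e d → ((r + s) * e + s) * d ≡ (r + s) * (e * d) + s * d
    distribute = solve-∀

abar-mod4-divisorCounts : ∀ r s n →
  abar r s (suc n) % 4 ≡ (2 * ((r + s) * evenDivisorCount (suc n) + s * divisorCount (suc n))) % 4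
abar-mod4-divisorCounts r s n = begin
  abar r s (suc n) % 4                  ≡⟨ abar-mod4 r s n ⟩
  (2 * C) % 4                           ≡⟨ [m+kn]%n≡m%n (2 * C) (s * E) 4 ⟨
  (2 * C + (s * E) * 4) % 4             ≡⟨ cong (_% 4) (regroup C (s * E)) ⟩
  (2 * (C + 2 * (s * E))) % 4           ≡⟨ cong (λ x → (2 * x) % 4) (colouredDivisorSum r s (suc n)) ⟩
  (2 * ((r + s) * E + s * divisorCount (suc n))) % 4 ∎
  where
  open ≡-Reasoning
  C E : ℕ
  C = ∑[ m < suc n ] colours r s (suc m) * 𝟙 (suc m ∣? suc n)
  E = evenDivisorCount (suc n)
  regroup : ∀ x y → 2 * x + y * 4 ≡ 2 * (x + 2 * y)
  regroup = solve-∀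

Square DoubleSquare : ℕ → Set
Square       n = ∃[ k ] n ≡ k * k
DoubleSquare n = ∃[ k ] n ≡ 2 * (k * k)

infix 4 _≡_mod2
_≡_mod2 : ℕ → ℕ → Set
x ≡ b mod2 = ∃[ q ] x ≡ b + 2 * q

divisors-as-pairs : ∀ n .{{_ : NonZero n}} a → 𝟙 (suc a ∣? n) ≡ ∑[ b < n ] 𝟙 (suc a * suc b ≟ n)
divisors-as-pairs n a with suc a ∣? n
... | no a∤n = sym (∑-zero n _ λ b _ → 𝟙-no (suc a * suc b ≟ n)
                      λ ab≡n → a∤n (divides (suc b) (trans (sym ab≡n) (*-comm (suc a) (suc b)))))
... | yes (divides zero n≡0) = contradiction n≡0 (≢-nonZero⁻¹ n)
... | yes (divides (suc b₀) n≡b₀a) =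
  sym (trans (∑-δ n _ b₀<n unique) (𝟙-yes (suc a * suc b₀ ≟ n) (sym n≡ab₀)))
  where
  n≡ab₀ : n ≡ suc a * suc b₀
  n≡ab₀ = trans n≡b₀a (*-comm (suc b₀) (suc a))
  b₀<n : b₀ < n
  b₀<n = subst (suc b₀ ≤_) (sym n≡b₀a) (m≤m*n (suc b₀) (suc a))
  unique : ∀ b → b < n → b ≢ b₀ → 𝟙 (suc a * suc b ≟ n) ≡ 0
  unique b _ b≢b₀ = 𝟙-no (suc a * suc b ≟ n)
    λ ab≡n → b≢b₀ (suc-injective (*-cancelˡ-≡ (suc b) (suc b₀) (suc a) (trans ab≡n n≡ab₀)))

-- The involution d ↦ n / d pairs off all divisors except a square root of n.
divisorCount-≡-squareRoots : ∀ n .{{_ : NonZero n}} →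
  divisorCount n ≡ (∑[ a < n ] 𝟙 (suc a * suc a ≟ n)) mod2
divisorCount-≡-squareRoots n = offDiagonal , trans (∑-cong n (λ a _ → divisors-as-pairs n a))
  (∑∑-symmetric n pair (λ a b → cong (λ x → 𝟙 (x ≟ n)) (*-comm (suc a) (suc b))))
  where
  pair : ℕ → ℕ → ℕ
  pair a b = 𝟙 (suc a * suc b ≟ n)
  offDiagonal : ℕ
  offDiagonal = ∑[ a < n ] ∑[ b < n ] 𝟙 (a <? b) * pair a b

square-injective : ∀ {a b} → a * a ≡ b * b → a ≡ b
square-injective {a} {b} a²≡b² with <-cmp a b
... | tri< a<b _ _ = contradiction a²≡b² (<⇒≢ (*-mono-< a<b a<b))
... | tri≈ _ a≡b _ = a≡b
... | tri> _ _ a>b = contradiction (sym a²≡b²) (<⇒≢ (*-mono-< a>b a>b))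

divisorCount-square : ∀ n .{{_ : NonZero n}} → Square n → divisorCount n ≡ 1 mod2
divisorCount-square n (zero , n≡0) = contradiction n≡0 (≢-nonZero⁻¹ n)
divisorCount-square n (suc a₀ , n≡a₀²) =
  subst (divisorCount n ≡_mod2) squareRoot (divisorCount-≡-squareRoots n)
  where
  a₀<n : a₀ < n
  a₀<n = subst (suc a₀ ≤_) (sym n≡a₀²) (m≤m*n (suc a₀) (suc a₀))
  squareRoot : (∑[ a < n ] 𝟙 (suc a * suc a ≟ n)) ≡ 1
  squareRoot = trans (∑-δ n _ a₀<n λ a _ a≢a₀ → 𝟙-no (suc a * suc a ≟ n)
                        λ a²≡n → a≢a₀ (suc-injective (square-injective (trans a²≡n n≡a₀²))))
                     (𝟙-yes (suc a₀ * suc a₀ ≟ n) (sym n≡a₀²))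

divisorCount-nonSquare : ∀ n .{{_ : NonZero n}} → ¬ Square n → divisorCount n ≡ 0 mod2
divisorCount-nonSquare n ¬square =
  subst (divisorCount n ≡_mod2) noSquareRoot (divisorCount-≡-squareRoots n)
  where
  noSquareRoot : (∑[ a < n ] 𝟙 (suc a * suc a ≟ n)) ≡ 0
  noSquareRoot = ∑-zero n _ λ a _ → 𝟙-no (suc a * suc a ≟ n) λ a²≡n → ¬square (suc a , sym a²≡n)

parity : ∀ n → n ≡ 0 mod2 ⊎ n ≡ 1 mod2
parity zero    = inj₁ (0 , refl)
parity (suc n) with parity n
... | inj₁ (N , n≡2N)   = inj₂ (N , cong suc n≡2N)
... | inj₂ (N , n≡1+2N) = inj₁ (suc N , trans (cong suc n≡1+2N) (sym (*-suc 2 N)))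

[2*n]%2≡0 : ∀ n → (2 * n) % 2 ≡ 0
[2*n]%2≡0 n = trans (cong (_% 2) (*-comm 2 n)) (m*n%n≡0 n 2)

[1+2*n]%2≡1 : ∀ n → (1 + 2 * n) % 2 ≡ 1
[1+2*n]%2≡1 n = trans (cong (λ x → (1 + x) % 2) (*-comm 2 n)) ([m+kn]%n≡m%n 1 n 2)

isEven-2* : ∀ j → isEven (2 * j) ≡ 1
isEven-2* j = 𝟙-yes (2 * j % 2 ≟ 0) ([2*n]%2≡0 j)

isEven-1+2* : ∀ j → isEven (1 + 2 * j) ≡ 0
isEven-1+2* j = 𝟙-no ((1 + 2 * j) % 2 ≟ 0) λ odd%2≡0 → 0≢1+n (trans (sym odd%2≡0) ([1+2*n]%2≡1 j))

evenDivisorCount-double : ∀ N → evenDivisorCount (2 * N) ≡ divisorCount N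
evenDivisorCount-double N = trans (∑-pairs N _) (∑-cong N λ j _ → pair j)
  where
  pair : ∀ j → isEven (1 + 2 * j) * 𝟙 (1 + 2 * j ∣? 2 * N) + isEven (2 + 2 * j) * 𝟙 (2 + 2 * j ∣? 2 * N)
             ≡ 𝟙 (suc j ∣? N)
  pair j = begin
    isEven (1 + 2 * j) * 𝟙 (1 + 2 * j ∣? 2 * N) + isEven (2 + 2 * j) * 𝟙 (2 + 2 * j ∣? 2 * N)
      ≡⟨ cong (λ x → isEven (1 + 2 * j) * 𝟙 (1 + 2 * j ∣? 2 * N) + isEven x * 𝟙 (x ∣? 2 * N))
              (*-suc 2 j) ⟨
    isEven (1 + 2 * j) * 𝟙 (1 + 2 * j ∣? 2 * N) + isEven (2 * suc j) * 𝟙 (2 * suc j ∣? 2 * N)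
      ≡⟨ cong₂ (λ x y → x * 𝟙 (1 + 2 * j ∣? 2 * N) + y * 𝟙 (2 * suc j ∣? 2 * N))
               (isEven-1+2* j) (isEven-2* (suc j)) ⟩
    𝟙 (2 * suc j ∣? 2 * N) + 0
      ≡⟨ +-identityʳ _ ⟩
    𝟙 (2 * suc j ∣? 2 * N)
      ≡⟨ 𝟙-cong (2 * suc j ∣? 2 * N) (suc j ∣? N) (*-cancelˡ-∣ 2) (*-monoʳ-∣ 2) ⟩
    𝟙 (suc j ∣? N)          ∎
    where open ≡-Reasoning

evenDivisorCount-odd : ∀ N → evenDivisorCount (1 + 2 * N) ≡ 0
evenDivisorCount-odd N = ∑-zero (1 + 2 * N) _ term
  where
  term : ∀ m → m < 1 + 2 * N → isEven (suc m) * 𝟙 (suc m ∣? 1 + 2 * N) ≡ 0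
  term m _ with suc m % 2 ≟ 0
  ... | no _     = refl
  ... | yes even = trans (*-identityˡ _) (𝟙-no (suc m ∣? 1 + 2 * N) λ m∣odd →
      0≢1+n (trans (sym (n∣m⇒m%n≡0 _ 2 (∣-trans (m%n≡0⇒n∣m (suc m) 2 even) m∣odd))) ([1+2*n]%2≡1 N)))

halve-square : ∀ k j → k * k ≡ 2 * (j * j) → ∃[ k′ ] k ≡ 2 * k′ × j * j ≡ 2 * (k′ * k′)
halve-square k j k²≡2j²
  with reduce (euclidsLemma k k prime[2] (divides (j * j) (trans k²≡2j² (*-comm 2 (j * j)))))
... | divides k′ k≡k′2 = k′ , trans k≡k′2 (*-comm k′ 2) , *-cancelˡ-≡ (j * j) (2 * (k′ * k′)) 2 (begin
  2 * (j * j)             ≡⟨ k²≡2j² ⟨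
  k * k                   ≡⟨ cong₂ _*_ k≡k′2 k≡k′2 ⟩
  k′ * 2 * (k′ * 2)       ≡⟨ regroup k′ ⟩
  2 * (2 * (k′ * k′))     ∎)
  where
  open ≡-Reasoning
  regroup : ∀ x → x * 2 * (x * 2) ≡ 2 * (2 * (x * x))
  regroup = solve-∀

-- Infinite descent: a solution (k, j) yields the smaller solution (k / 2, j / 2).
k*k≡2*[j*j]⇒k≡0 : ∀ k j → k * k ≡ 2 * (j * j) → k ≡ 0
k*k≡2*[j*j]⇒k≡0 = <-rec _ descent
  where
  descent : ∀ k → (∀ {k′} → k′ < k → ∀ j → k′ * k′ ≡ 2 * (j * j) → k′ ≡ 0) →
            ∀ j → k * k ≡ 2 * (j * j) → k ≡ 0
  descent k smaller j k²≡2j² with halve-square k j k²≡2j²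
  ... | k′ , k≡2k′ , j²≡2k′² with halve-square j k′ j²≡2k′²
  ...   | j′ , _ , k′²≡2j′² with k′
  ...     | zero   = k≡2k′
  ...     | suc k″ = contradiction (smaller k′<k j′ k′²≡2j′²) λ ()
    where
    k′<k : suc k″ < k
    k′<k = subst (suc k″ <_) (sym k≡2k′) (m<m+n (suc k″) z<s)

square⇒¬doubleSquare : ∀ n .{{_ : NonZero n}} → Square n → ¬ DoubleSquare n
square⇒¬doubleSquare n (k , n≡k²) (j , n≡2j²) = ≢-nonZero⁻¹ n (begin
  n       ≡⟨ n≡k² ⟩
  k * k   ≡⟨ cong (λ x → x * x) (k*k≡2*[j*j]⇒k≡0 k j (trans (sym n≡k²) n≡2j²)) ⟩
  0       ∎)
  where open ≡-Reasoning

evenDivisorCount-doubleSquare : ∀ n .{{_ : NonZero n}} → DoubleSquare n → evenDivisorCount n ≡ 1 mod2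
evenDivisorCount-doubleSquare n (zero , n≡0) = contradiction n≡0 (≢-nonZero⁻¹ n)
evenDivisorCount-doubleSquare n (k@(suc _) , n≡2k²) =
  subst (_≡ 1 mod2) (sym (trans (cong evenDivisorCount n≡2k²) (evenDivisorCount-double (k * k))))
        (divisorCount-square (k * k) (k , refl))

evenDivisorCount-nonDoubleSquare : ∀ n .{{_ : NonZero n}} → ¬ DoubleSquare n → evenDivisorCount n ≡ 0 mod2
evenDivisorCount-nonDoubleSquare n ¬doubleSquare with parity n
... | inj₂ (N , n≡1+2N) = 0 , trans (cong evenDivisorCount n≡1+2N) (evenDivisorCount-odd N)
... | inj₁ (zero , n≡0) = contradiction n≡0 (≢-nonZero⁻¹ n)
... | inj₁ (N@(suc _) , n≡2N) =
  subst (_≡ 0 mod2) (sym (trans (cong evenDivisorCount n≡2N) (evenDivisorCount-double N)))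
        (divisorCount-nonSquare N λ (k , N≡k²) → ¬doubleSquare (k , trans n≡2N (cong (2 *_) N≡k²)))

twice-mod4 : ∀ a b {x x′ y y′} → x ≡ x′ mod2 → y ≡ y′ mod2 →
             (2 * (a * x + b * y)) % 4 ≡ (2 * (a * x′ + b * y′)) % 4
twice-mod4 a b {x′ = x′} {y′ = y′} (p , refl) (q , refl) =
  trans (cong (_% 4) (expand a b x′ y′ p q)) ([m+kn]%n≡m%n (2 * (a * x′ + b * y′)) (a * p + b * q) 4)
  where
  expand : ∀ a b x y p q → 2 * (a * (x + 2 * p) + b * (y + 2 * q)) ≡ 2 * (a * x + b * y) + (a * p + b * q) * 4
  expand = solve-∀

abar-mod4-parities : ∀ r s n {e t} → evenDivisorCount (suc n) ≡ e mod2 → divisorCount (suc n) ≡ t mod2 →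
  abar r s (suc n) % 4 ≡ (2 * ((r + s) * e + s * t)) % 4
abar-mod4-parities r s n E≡e τ≡t = trans (abar-mod4-divisorCounts r s n) (twice-mod4 (r + s) s E≡e τ≡t)

theorem1p3 : (r s : ℕ) → 1 ≤ r → 1 ≤ s → (n : ℕ) → 1 ≤ n →
    ((∃[ k ] n ≡ k * k) → abar r s n % 4 ≡ (2 * s) % 4)
    × ((∃[ k ] n ≡ 2 * (k * k)) → abar r s n % 4 ≡ (2 * (r + s)) % 4)
    × (¬ (∃[ k ] n ≡ k * k) → ¬ (∃[ k ] n ≡ 2 * (k * k)) → abar r s n % 4 ≡ 0)
theorem1p3 r s _ _ zero    ()
theorem1p3 r s _ _ (suc m) _  = square , doubleSquare , neither
  where
  open ≡-Reasoning
  n : ℕ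
  n = suc m
  square : Square n → abar r s n % 4 ≡ (2 * s) % 4
  square sq = begin
    abar r s n % 4
      ≡⟨ abar-mod4-parities r s m (evenDivisorCount-nonDoubleSquare n (square⇒¬doubleSquare n sq))
                                  (divisorCount-square n sq) ⟩
    (2 * ((r + s) * 0 + s * 1)) % 4
      ≡⟨ cong (λ x → (2 * (x + s * 1)) % 4) (*-zeroʳ (r + s)) ⟩
    (2 * (s * 1)) % 4
      ≡⟨ cong (λ x → (2 * x) % 4) (*-identityʳ s) ⟩
    (2 * s) % 4               ∎
  doubleSquare : DoubleSquare n → abar r s n % 4 ≡ (2 * (r + s)) % 4
  doubleSquare dsq = begin
    abar r s n % 4
      ≡⟨ abar-mod4-parities r s m (evenDivisorCount-doubleSquare n dsq)
                                  (divisorCount-nonSquare n λ sq → square⇒¬doubleSquare n sq dsq) ⟩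
    (2 * ((r + s) * 1 + s * 0)) % 4
      ≡⟨ cong₂ (λ x y → (2 * (x + y)) % 4) (*-identityʳ (r + s)) (*-zeroʳ s) ⟩
    (2 * (r + s + 0)) % 4
      ≡⟨ cong (λ x → (2 * x) % 4) (+-identityʳ (r + s)) ⟩
    (2 * (r + s)) % 4         ∎
  neither : ¬ Square n → ¬ DoubleSquare n → abar r s n % 4 ≡ 0
  neither ¬sq ¬dsq = begin
    abar r s n % 4
      ≡⟨ abar-mod4-parities r s m (evenDivisorCount-nonDoubleSquare n ¬dsq) (divisorCount-nonSquare n ¬sq) ⟩
    (2 * ((r + s) * 0 + s * 0)) % 4
      ≡⟨ cong₂ (λ x y → (2 * (x + y)) % 4) (*-zeroʳ (r + s)) (*-zeroʳ s) ⟩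
    0                         ∎
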